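{- Let $\mathcal U$ be a universe and $G\in\mathcal U$. Let $A$ be a Left option of $G$ that is end-reversible modulo $\mathcal U$, i.e. $A$ has a Right option $B$ with no Left options and $B\leq_{\mathcal U}G$. Let $X\in\mathcal U$ have at least one Left option. If $o_R(A+X)=\mathrm L$ (Left, moving first in $G+X$, wins by moving to $A+X$), then there is a Left option $X^L$ of $X$ with $o_R(G+X^L)=\mathrm L$ (Left also wins by moving to $G+X^L$).
   Context: All games are short two-player partizan games between Left and Right, identified with their game trees: $G=\{G^{\mathcal L}\mid G^{\mathcal R}\}$ with finite sets of options; $\mathcal M$ is the class of all such games. Disjunctive sum: $G+H=\{G^{\mathcal L}+H,G+H^{\mathcal L}\mid G^{\mathcal R}+H,G+H^{\mathcal R}\}$. Conjugate: $\overline G=\{\overline{G^{\mathcal R}}\mid\overline{G^{\mathcal L}}\}$. Misère play: a player with no move on their turn wins. $o_L(G)=\mathrm L$ if $G^{\mathcal L}=\emptyset$, else $\max_{G^L}o_R(G^L)$; $o_R(G)=\mathrm R$ if $G^{\mathcal R}=\emptyset$, else $\min_{G^R}o_L(G^R)$; $\mathrm L>\mathrm R$. Outcome $o(G)=(o_L(G),o_R(G))$, ordered componentwise. A universe is a nonempty class $\mathcal U\subseteq\mathcal M$ closed under options, disjunctive sums and conjugates. $G\geq_{\mathcal U}H$ means $o(G+X)\geq o(H+X)$ for all $X\in\mathcal U$. -}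

module Defs where

open import Data.List using (List; []; _∷_; _++_)
open import Data.List.Membership.Propositional using (_∈_)
open import Data.Product using (_×_; ∃)

data Game : Set where
  ⟨_∣_⟩ : List Game → List Game → Game

lefts : Game → List Game
lefts ⟨ l ∣ _ ⟩ = l

rights : Game → List Game
rights ⟨ _ ∣ r ⟩ = r

data Player : Set where
  L R : Player

_∨P_ : Player → Player → Player
L ∨P _ = L
R ∨P q = q

_∧P_ : Player → Player → Player
R ∧P _ = R
L ∧P q = q

data _≥P_ : Player → Player → Set where
  L≥ : ∀ {p} → L ≥P p
  R≥R : R ≥P R

-- Misère outcome functions.
mutual
  oL : Game → Player
  oL ⟨ [] ∣ _ ⟩ = L
  oL ⟨ x ∷ xs ∣ _ ⟩ = maxOR (x ∷ xs)

  oR : Game → Player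
  oR ⟨ _ ∣ [] ⟩ = R
  oR ⟨ _ ∣ y ∷ ys ⟩ = minOL (y ∷ ys)

  -- maximum of oR over a nonempty list (R is the bottom element)
  maxOR : List Game → Player
  maxOR [] = R
  maxOR (x ∷ xs) = oR x ∨P maxOR xs

  -- minimum of oL over a nonempty list (L is the top element)
  minOL : List Game → Player
  minOL [] = L
  minOL (x ∷ xs) = oL x ∧P minOL xs

_≥O_ : Game → Game → Set
G ≥O H = (oL G ≥P oL H) × (oR G ≥P oR H)

mutual
  infixl 6 _+_
  _+_ : Game → Game → Game
  ⟨ gl ∣ gr ⟩ + H@(⟨ hl ∣ hr ⟩) =
    ⟨ mapL gl H ++ mapR ⟨ gl ∣ gr ⟩ hl ∣ mapL gr H ++ mapR ⟨ gl ∣ gr ⟩ hr ⟩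

  mapL : List Game → Game → List Game
  mapL [] H = []
  mapL (x ∷ xs) H = (x + H) ∷ mapL xs H

  mapR : Game → List Game → List Game
  mapR G [] = []
  mapR G (y ∷ ys) = (G + y) ∷ mapR G ys

mutual
  conj : Game → Game
  conj ⟨ gl ∣ gr ⟩ = ⟨ conjList gr ∣ conjList gl ⟩

  conjList : List Game → List Game
  conjList [] = []
  conjList (x ∷ xs) = conj x ∷ conjList xs

record IsUniverse (U : Game → Set) : Set where
  field
    nonempty  : ∃ U
    leftClosed  : ∀ {G GL} → U G → GL ∈ lefts G → U GL
    rightClosed : ∀ {G GR} → U G → GR ∈ rights G → U GR
    sumClosed   : ∀ {G H} → U G → U H → U (G + H)
    conjClosed  : ∀ {G} → U G → U (conj G)

_≥[_]_ : Game → (Game → Set) → Game → Set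
G ≥[ U ] H = ∀ X → U X → (G + X) ≥O (H + X)

module Submission where

-- Left wins moving second in A + X, so in particular she wins
-- moving first after Right's reply B + X, where B is the Right option of A
-- with no Left options.  Since B has no Left options, Left's moves in B + X
-- are exactly the moves B + X^L, and there is at least one because X has a
-- Left option; so some B + X^L is a win for Left moving second.  Finally
-- G ≥_U B (tested against X^L ∈ U) lifts oR (B + X^L) = L to
-- oR (G + X^L) = L.

open import Defs
open import Data.List using (List; []; _∷_)
open import Data.List.Membership.Propositional using (_∈_)
open import Data.List.Membership.Propositional.Properties using (∈-++⁺ˡ)
open import Data.List.Relation.Unary.Any using (here; there)
open import Data.Product using (∃; _×_; _,_)
open import Data.Empty using (⊥-elim)
open import Relation.Binary.PropositionalEquality using (_≡_; _≢_; refl; sym; trans; subst)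

minOL≡L⇒all : ∀ xs {y} → minOL xs ≡ L → y ∈ xs → oL y ≡ L
minOL≡L⇒all (x ∷ xs) e y∈ with oL x in oLx≡ | y∈
... | L | here refl = oLx≡
... | L | there y∈xs = minOL≡L⇒all xs e y∈xs

maxOR≡L⇒any : ∀ xs → maxOR xs ≡ L → ∃ λ y → y ∈ xs × oR y ≡ L
maxOR≡L⇒any (x ∷ xs) e with oR x in oRx≡
... | L = x , here refl , oRx≡
... | R with maxOR≡L⇒any xs e
...   | y , y∈ , oRy≡ = y , there y∈ , oRy≡

oR≡L⇒rightOptions : ∀ {G GR} → oR G ≡ L → GR ∈ rights G → oL GR ≡ L
oR≡L⇒rightOptions {⟨ _ ∣ y ∷ ys ⟩} e GR∈ = minOL≡L⇒all (y ∷ ys) e GR∈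

oL≡L⇒winningLeftOption : ∀ {G} → oL G ≡ L → lefts G ≢ [] →
  ∃ λ GL → GL ∈ lefts G × oR GL ≡ L
oL≡L⇒winningLeftOption {⟨ [] ∣ _ ⟩} _ nonempty = ⊥-elim (nonempty refl)
oL≡L⇒winningLeftOption {⟨ x ∷ xs ∣ _ ⟩} e _ = maxOR≡L⇒any (x ∷ xs) e

∈-mapL : ∀ {x} xs H → x ∈ xs → (x + H) ∈ mapL xs H
∈-mapL (_ ∷ _) H (here refl) = here refl
∈-mapL (_ ∷ xs) H (there x∈) = there (∈-mapL xs H x∈)

∈-mapR⁻ : ∀ G ys {z} → z ∈ mapR G ys → ∃ λ y → y ∈ ys × z ≡ G + y
∈-mapR⁻ G (y ∷ _) (here refl) = y , here refl , refl
∈-mapR⁻ G (_ ∷ ys) (there z∈) with ∈-mapR⁻ G ys z∈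
... | y , y∈ , z≡ = y , there y∈ , z≡

rightOption-+ˡ : ∀ {G GR} H → GR ∈ rights G → (GR + H) ∈ rights (G + H)
rightOption-+ˡ {⟨ _ ∣ gr ⟩} ⟨ _ ∣ _ ⟩ GR∈ = ∈-++⁺ˡ (∈-mapL gr _ GR∈)

lefts-+-of-leftEnd : ∀ {G} H → lefts G ≡ [] → lefts (G + H) ≡ mapR G (lefts H)
lefts-+-of-leftEnd {⟨ [] ∣ _ ⟩} ⟨ _ ∣ _ ⟩ refl = refl

mapR-nonempty : ∀ G {ys} → ys ≢ [] → mapR G ys ≢ []
mapR-nonempty G {[]} ne _ = ⊥-elim (ne refl)
mapR-nonempty G {_ ∷ _} _ ()

leftEnd-+-winningMove : ∀ {G} H → lefts G ≡ [] → oL (G + H) ≡ L → lefts H ≢ [] →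
  ∃ λ HL → HL ∈ lefts H × oR (G + HL) ≡ L
leftEnd-+-winningMove {G} H noLeftG oL≡L leftsH≢[]
  with oL≡L⇒winningLeftOption {G + H} oL≡L leftsG+H≢[]
  where
    leftsG+H≢[] : lefts (G + H) ≢ []
    leftsG+H≢[] leftsG+H≡[] =
      mapR-nonempty G leftsH≢[] (trans (sym (lefts-+-of-leftEnd H noLeftG)) leftsG+H≡[])
... | Y , Y∈ , oRY≡L
  with ∈-mapR⁻ G (lefts H) (subst (Y ∈_) (lefts-+-of-leftEnd H noLeftG) Y∈)
... | HL , HL∈ , refl = HL , HL∈ , oRY≡L

≥P-L : ∀ {p q} → p ≥P q → q ≡ L → p ≡ L
≥P-L L≥ _ = refl
≥P-L R≥R e = e

≥U-transfers-oR : ∀ {U G H X} → G ≥[ U ] H → U X →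
  oR (H + X) ≡ L → oR (G + X) ≡ L
≥U-transfers-oR {X = X} G≥H UX e with G≥H X UX
... | _ , oR≥ = ≥P-L oR≥ e

mainTheorem7 : (U : Game → Set) → IsUniverse U →
    (G : Game) → U G →
    (A : Game) → A ∈ lefts G →
    (B : Game) → B ∈ rights A → lefts B ≡ [] → G ≥[ U ] B →
    (X : Game) → U X → lefts X ≢ [] →
    oR (A + X) ≡ L →
    ∃ λ XL → XL ∈ lefts X × oR (G + XL) ≡ L
mainTheorem7 U isU G _ A _ B B∈A noLeftB G≥B X UX leftsX≢[] oR[A+X]≡L
  with leftEnd-+-winningMove {B} X noLeftB oL[B+X]≡L leftsX≢[]
  where
    -- Right may answer A + X by moving to B + X.
    oL[B+X]≡L : oL (B + X) ≡ L
    oL[B+X]≡L = oR≡L⇒rightOptions {A + X} oR[A+X]≡L (rightOption-+ˡ {A} X B∈A)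
... | XL , XL∈ , oR[B+XL]≡L =
  XL , XL∈ , ≥U-transfers-oR {G = G} {B} G≥B (IsUniverse.leftClosed isU UX XL∈) oR[B+XL]≡L
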